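{- Let $q$ be a prime power and let $S$ be a set of $q+1$ points in $\mathrm{PG}(2,q)$. If $S$ has degree at most $3$, then $u_0(S)\ge q(q-2)/3$. If $S$ has degree at most $4$ and $u_3(S)=c$, then $u_0(S)\ge (q^2-3q+2c)/4$.
   Context: $\mathrm{PG}(2,q)$ is the projective plane over $\mathbb{F}_q$. For a set $S$ of $q+1$ points, $u_i(S)$ is the number of lines of $\mathrm{PG}(2,q)$ containing exactly $i$ points of $S$, and the degree of $S$ is the largest $i$ with $u_i(S)\neq 0$. -}

module Defs where

open import Data.Nat using (ℕ; _⊔_)
open import Data.Fin using (Fin)
open import Data.Fin.Properties using (_≟_)
open import Data.Bool using (Bool; true; false; _∧_; _∨_)
open import Data.Product using (_×_; _,_)
open import Data.List using (List; length; filter; map; foldr; allFin; cartesianProduct)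
open import Relation.Nullary using (¬_)
open import Relation.Nullary.Decidable using (⌊_⌋)
open import Relation.Binary.PropositionalEquality using (_≡_)
open import Algebra.Core using (Op₁; Op₂)
import Algebra.Structures as AS

-- A finite field with exactly q elements, carrier Fin q, equality ≡.
-- (Up to isomorphism this is F_q; such a field exists iff q is a prime power.)
record FiniteField (q : ℕ) : Set where
  field
    _+_ _*_ : Op₂ (Fin q)
    -_      : Op₁ (Fin q)
    0# 1#   : Fin q
    isCommutativeRing : AS.IsCommutativeRing (_≡_ {A = Fin q}) _+_ _*_ -_ 0# 1#
    0≢1     : ¬ (0# ≡ 1#)
    _⁻¹     : Op₁ (Fin q)
    inverseˡ : ∀ x → ¬ (x ≡ 0#) → (x ⁻¹) * x ≡ 1#
  infixl 6 _+_
  infixl 7 _*_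

module PG2 {q : ℕ} (F : FiniteField q) where
  open FiniteField F

  Vec3 : Set
  Vec3 = Fin q × Fin q × Fin q

  allVec3 : List Vec3
  allVec3 = cartesianProduct (allFin q) (cartesianProduct (allFin q) (allFin q))

  eqb : Fin q → Fin q → Bool
  eqb x y = ⌊ x ≟ y ⌋

  -- canonical representative of a projective point / line:
  -- first nonzero coordinate equals 1
  normalized : Vec3 → Bool
  normalized (a , b , c) =
    eqb a 1# ∨ (eqb a 0# ∧ eqb b 1#) ∨ (eqb a 0# ∧ eqb b 0# ∧ eqb c 1#)

  Point : Set
  Point = Vec3

  IsPoint : Vec3 → Set
  IsPoint v = normalized v ≡ true

  allLines : List Vec3
  allLines = filter (λ v → normalized v Data.Bool.≟ true) allVec3

  incident : Vec3 → Vec3 → Bool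
  incident (x₀ , x₁ , x₂) (l₀ , l₁ , l₂) = eqb ((x₀ * l₀ + x₁ * l₁) + x₂ * l₂) 0#

  pointsOn : List Vec3 → Vec3 → ℕ
  pointsOn S l = length (filter (λ x → incident x l Data.Bool.≟ true) S)

  u : ℕ → List Vec3 → ℕ
  u i S = length (filter (λ l → pointsOn S l Data.Nat.≟ i) allLines)

  -- degree: largest i with u i S ≠ 0, i.e. the maximum of pointsOn S l over all lines
  degree : List Vec3 → ℕ
  degree S = foldr _⊔_ 0 (map (pointsOn S) allLines)

{-# OPTIONS --safe #-}
-- Write k_l for the number of points of S on the line l. Every point lies on q + 1 lines, and two
-- distinct points lie on a common line (their normalized cross product), so ∑ k_l = (q + 1)² and
-- ∑ k_l² ≥ 2(q + 1)² - (q + 1). If every k_l ≤ d then (k_l - 1)(k_l - d) ≤ 0 whenever k_l ≠ 0, i.e.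
-- d + k_l² ≤ d·[k_l = 0] + (d + 1)·k_l; summing over the q² + q + 1 lines gives d·u₀ ≥ q² - (d - 1)q.
-- For d = 4 a line with k_l = 3 leaves slack 2 in that inequality, which accounts for the 2·u₃.
module Submission where

open import Defs
open import Algebra.Bundles using (CommutativeRing)
import Algebra.Properties.Group as GroupProperties
import Algebra.Solver.Ring.NaturalCoefficients.Default as SemiringSolver
open import Data.Bool as Bool using (Bool; true; false)
open import Data.Empty using (⊥-elim)
open import Data.Fin using (Fin)
open import Data.Fin.Properties using (_≟_)
open import Data.List using (List; []; _∷_; length; filter; map; _++_; allFin; cartesianProduct)
open import Data.List.Properties using (length-tabulate; foldr-forcesᵇ)
open import Data.List.Membership.Propositional using (_∈_; _∉_)
open import Data.List.Membership.Propositional.Properties using (∈-filter⁺; ∈-cartesianProduct⁺; ∈-allFin)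
open import Data.List.Relation.Unary.All as All using (All; []; _∷_)
open import Data.List.Relation.Unary.All.Properties using (All¬⇒¬Any; map⁻)
open import Data.List.Relation.Unary.Any using (here; there)
open import Data.List.Relation.Unary.AllPairs using ([]; _∷_)
open import Data.List.Relation.Unary.Unique.Propositional using (Unique)
open import Data.List.Relation.Unary.Unique.Propositional.Properties using (allFin⁺)
open import Data.Nat as ℕ using (ℕ; suc; _≤_; z≤n; s≤s)
open import Data.Nat.Properties as ℕ using (≤-trans; ≤-reflexive; m⊔n≤o⇒m≤o; m⊔n≤o⇒n≤o; ≤ᵇ⇒≤)
open import Data.Product using (Σ-syntax; _×_; _,_; proj₁; proj₂)
open import Function using (_∘_; id; case_of_)
open import Function.Bundles using (_⇔_; mk⇔)
open import Relation.Binary.Definitions using (DecidableEquality)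
open import Relation.Binary.PropositionalEquality hiding ([_])
open import Relation.Nullary using (does)
open import Relation.Nullary.Decidable using (⌊_⌋; yes; no; isYes≗does; dec-true; dec-false; does-⇔)
open import Relation.Unary using (Decidable)

module Sum where
  open import Data.Nat using (_+_; _*_)
  open import Data.Nat.Properties
  open import Algebra.Properties.CommutativeSemigroup +-commutativeSemigroup using (interchange)

  [_] : Bool → ℕ
  [ true ] = 1
  [ false ] = 0

  ∑ : {A : Set} → List A → (A → ℕ) → ℕ
  ∑ [] f = 0
  ∑ (x ∷ xs) f = f x + ∑ xs f

  ∑-syntax : {A : Set} → List A → (A → ℕ) → ℕ
  ∑-syntax = ∑

  infix 6.5 ∑-syntax
  syntax ∑-syntax xs (λ x → e) = ∑[ x ∈ xs ] e

  module _ {A : Set} where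

    ∑-cong : ∀ (xs : List A) {f g : A → ℕ} → (∀ x → f x ≡ g x) → ∑ xs f ≡ ∑ xs g
    ∑-cong [] f≗g = refl
    ∑-cong (x ∷ xs) f≗g = cong₂ _+_ (f≗g x) (∑-cong xs f≗g)

    ∑-mono-≤ : ∀ {xs : List A} {f g : A → ℕ} → All (λ x → f x ≤ g x) xs → ∑ xs f ≤ ∑ xs g
    ∑-mono-≤ [] = z≤n
    ∑-mono-≤ (fx≤gx ∷ f≤g) = +-mono-≤ fx≤gx (∑-mono-≤ f≤g)

    ∑-distrib-+ : ∀ (xs : List A) (f g : A → ℕ) → ∑[ x ∈ xs ] (f x + g x) ≡ ∑ xs f + ∑ xs g
    ∑-distrib-+ [] f g = refl
    ∑-distrib-+ (x ∷ xs) f g =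
      trans (cong (f x + g x +_) (∑-distrib-+ xs f g)) (interchange (f x) (g x) (∑ xs f) (∑ xs g))

    ∑-distribˡ-* : ∀ (xs : List A) k (f : A → ℕ) → ∑[ x ∈ xs ] k * f x ≡ k * ∑ xs f
    ∑-distribˡ-* [] k f = sym (*-zeroʳ k)
    ∑-distribˡ-* (x ∷ xs) k f = trans (cong (k * f x +_) (∑-distribˡ-* xs k f)) (sym (*-distribˡ-+ k (f x) _))

    ∑-linear : ∀ (xs : List A) m n (f g : A → ℕ) → ∑[ x ∈ xs ] (m * f x + n * g x) ≡ m * ∑ xs f + n * ∑ xs g
    ∑-linear xs m n f g =
      trans (∑-distrib-+ xs _ _) (cong₂ _+_ (∑-distribˡ-* xs m f) (∑-distribˡ-* xs n g))

    ∑-const : ∀ (xs : List A) k → ∑[ _ ∈ xs ] k ≡ length xs * k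
    ∑-const [] k = refl
    ∑-const (x ∷ xs) k = cong (k +_) (∑-const xs k)

    ∑-++ : ∀ (xs ys : List A) (f : A → ℕ) → ∑ (xs ++ ys) f ≡ ∑ xs f + ∑ ys f
    ∑-++ [] ys f = refl
    ∑-++ (x ∷ xs) ys f = trans (cong (f x +_) (∑-++ xs ys f)) (sym (+-assoc (f x) _ _))

    ∈⇒≤∑ : ∀ {xs : List A} {x} (f : A → ℕ) → x ∈ xs → f x ≤ ∑ xs f
    ∈⇒≤∑ {y ∷ xs} f (here refl) = m≤m+n (f y) (∑ xs f)
    ∈⇒≤∑ {y ∷ xs} f (there x∈xs) = ≤-trans (∈⇒≤∑ f x∈xs) (m≤n+m (∑ xs f) (f y))

    module _ {p} {P : A → Set p} (P? : Decidable P) where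

      length-filter≡∑ : ∀ xs → length (filter P? xs) ≡ ∑[ x ∈ xs ] [ does (P? x) ]
      length-filter≡∑ [] = refl
      length-filter≡∑ (x ∷ xs) with does (P? x)
      ... | true = cong suc (length-filter≡∑ xs)
      ... | false = length-filter≡∑ xs

      ∑-filter : ∀ xs (f : A → ℕ) → ∑ (filter P? xs) f ≡ ∑[ x ∈ xs ] [ does (P? x) ] * f x
      ∑-filter [] f = refl
      ∑-filter (x ∷ xs) f with does (P? x)
      ... | true = cong₂ _+_ (sym (+-identityʳ (f x))) (∑-filter xs f)
      ... | false = ∑-filter xs f

    module _ (_≟ᴬ_ : DecidableEquality A) where

      ∑-δ-∉ : ∀ {xs t} (f : A → ℕ) → t ∉ xs → ∑[ x ∈ xs ] [ ⌊ x ≟ᴬ t ⌋ ] * f x ≡ 0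
      ∑-δ-∉ {[]} f t∉xs = refl
      ∑-δ-∉ {x ∷ xs} {t} f t∉xs with x ≟ᴬ t
      ... | yes refl = ⊥-elim (t∉xs (here refl))
      ... | no _ = ∑-δ-∉ f (t∉xs ∘ there)

      ∑-δ : ∀ {xs t} (f : A → ℕ) → Unique xs → t ∈ xs → ∑[ x ∈ xs ] [ ⌊ x ≟ᴬ t ⌋ ] * f x ≡ f t
      ∑-δ {x ∷ xs} f (x∉xs ∷ _) (here refl) with x ≟ᴬ x
      ... | yes _ = trans (cong₂ _+_ (+-identityʳ (f x)) (∑-δ-∉ f (All¬⇒¬Any x∉xs))) (+-identityʳ (f x))
      ... | no x≢x = ⊥-elim (x≢x refl)
      ∑-δ {x ∷ xs} {t} f (x∉xs ∷ xs!) (there t∈xs) with x ≟ᴬ t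
      ... | yes refl = ⊥-elim (All¬⇒¬Any x∉xs t∈xs)
      ... | no _ = ∑-δ f xs! t∈xs

  ∑-map : ∀ {A B : Set} (g : A → B) (xs : List A) (f : B → ℕ) → ∑ (map g xs) f ≡ ∑[ x ∈ xs ] f (g x)
  ∑-map g [] f = refl
  ∑-map g (x ∷ xs) f = cong (f (g x) +_) (∑-map g xs f)

  ∑-cartesianProduct : ∀ {A B : Set} (xs : List A) (ys : List B) (f : A × B → ℕ) →
                       ∑ (cartesianProduct xs ys) f ≡ ∑[ x ∈ xs ] ∑[ y ∈ ys ] f (x , y)
  ∑-cartesianProduct [] ys f = refl
  ∑-cartesianProduct (x ∷ xs) ys f =
    trans (∑-++ (map (x ,_) ys) _ f) (cong₂ _+_ (∑-map (x ,_) ys f) (∑-cartesianProduct xs ys f))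

open Sum

module Geometry {q : ℕ} (F : FiniteField q) where
  open FiniteField F
  open PG2 F

  private
    ring : CommutativeRing _ _
    ring = record { isCommutativeRing = isCommutativeRing }

  open CommutativeRing ring
    using (+-group; commutativeSemiring; _-_; *-comm; *-assoc; *-identityˡ; *-identityʳ;
           zeroˡ; zeroʳ; +-identityʳ; -‿inverseʳ)
  open GroupProperties +-group using (x∙y⁻¹≈ε⇒x≈y; inverseʳ-unique; identityˡ-unique; //-rightDividesˡ)
  open SemiringSolver commutativeSemiring using (solve; _:+_; _:*_; _:=_; con)

  1≢0 : 1# ≢ 0#
  1≢0 = 0≢1 ∘ sym

  1*1≢zero : ∀ {z} → z ≡ 0# → 1# * 1# ≢ z
  1*1≢zero z≡0 1≡z = 1≢0 (trans (sym (*-identityʳ 1#)) (trans 1≡z z≡0))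

  x*x⁻¹≡1 : ∀ {x} → x ≢ 0# → x * x ⁻¹ ≡ 1#
  x*x⁻¹≡1 {x} x≢0 = trans (*-comm x (x ⁻¹)) (inverseˡ x x≢0)

  linear-root : ∀ {c} K t → c ≢ 0# → (K + c * t ≡ 0#) ⇔ (t ≡ c ⁻¹ * - K)
  linear-root {c} K t c≢0 = mk⇔ to from
    where
    open ≡-Reasoning
    to : K + c * t ≡ 0# → t ≡ c ⁻¹ * - K
    to K+ct≡0 = begin
      t              ≡⟨ *-identityˡ t ⟨
      1# * t         ≡⟨ cong (_* t) (inverseˡ c c≢0) ⟨
      c ⁻¹ * c * t   ≡⟨ *-assoc (c ⁻¹) c t ⟩
      c ⁻¹ * (c * t) ≡⟨ cong (c ⁻¹ *_) (inverseʳ-unique K (c * t) K+ct≡0) ⟩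
      c ⁻¹ * - K     ∎
    from : t ≡ c ⁻¹ * - K → K + c * t ≡ 0#
    from refl = begin
      K + c * (c ⁻¹ * - K) ≡⟨ cong (K +_) (*-assoc c (c ⁻¹) (- K)) ⟨
      K + c * c ⁻¹ * - K   ≡⟨ cong (λ z → K + z * - K) (x*x⁻¹≡1 c≢0) ⟩
      K + 1# * - K         ≡⟨ cong (K +_) (*-identityˡ (- K)) ⟩
      K + - K              ≡⟨ -‿inverseʳ K ⟩
      0#                   ∎

  eqb-≡ : ∀ {x y} → x ≡ y → eqb x y ≡ true
  eqb-≡ {x} {y} x≡y = trans (isYes≗does (x ≟ y)) (dec-true (x ≟ y) x≡y)

  eqb-≢ : ∀ {x y} → x ≢ y → eqb x y ≡ false
  eqb-≢ {x} {y} x≢y = trans (isYes≗does (x ≟ y)) (dec-false (x ≟ y) x≢y)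

  eqb-⇔ : ∀ {x y z w} → (x ≡ y) ⇔ (z ≡ w) → eqb x y ≡ eqb z w
  eqb-⇔ {x} {y} {z} {w} x≡y⇔z≡w =
    trans (isYes≗does (x ≟ y)) (trans (does-⇔ x≡y⇔z≡w (x ≟ y) (z ≟ w)) (sym (isYes≗does (z ≟ w))))

  ∑-δ-allFin : ∀ t (f : Fin q → ℕ) → ∑[ x ∈ allFin q ] [ eqb x t ] ℕ.* f x ≡ f t
  ∑-δ-allFin t f = ∑-δ _≟_ f (allFin⁺ q) (∈-allFin t)

  ∑-allFin-const : ∀ k → ∑[ _ ∈ allFin q ] k ≡ q ℕ.* k
  ∑-allFin-const k = trans (∑-const (allFin q) k) (cong (ℕ._* k) (length-tabulate {n = q} id))

  ∑-allFin-1 : ∑[ _ ∈ allFin q ] 1 ≡ q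
  ∑-allFin-1 = trans (∑-allFin-const 1) (ℕ.*-identityʳ q)

  roots-linear : ∀ {c} K → c ≢ 0# → ∑[ t ∈ allFin q ] [ eqb (K + c * t) 0# ] ≡ 1
  roots-linear {c} K c≢0 = begin
    ∑[ t ∈ allFin q ] [ eqb (K + c * t) 0# ]
      ≡⟨ ∑-cong (allFin q) (λ t → cong [_] (eqb-⇔ (linear-root K t c≢0))) ⟩
    ∑[ t ∈ allFin q ] [ eqb t (c ⁻¹ * - K) ]
      ≡⟨ ∑-cong (allFin q) (λ t → ℕ.*-identityʳ _) ⟨
    ∑[ t ∈ allFin q ] [ eqb t (c ⁻¹ * - K) ] ℕ.* 1
      ≡⟨ ∑-δ-allFin (c ⁻¹ * - K) (λ _ → 1) ⟩
    1 ∎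
    where open ≡-Reasoning

  roots-constant : ∀ K → ∑[ t ∈ allFin q ] [ eqb (K + 0# * t) 0# ] ≡ q ℕ.* [ eqb K 0# ]
  roots-constant K = trans (∑-cong (allFin q) K+0t≗K) (∑-allFin-const _)
    where
    K+0t≗K : ∀ t → [ eqb (K + 0# * t) 0# ] ≡ [ eqb K 0# ]
    K+0t≗K t = cong (λ z → [ eqb z 0# ]) (trans (cong (K +_) (zeroˡ t)) (+-identityʳ K))

  data Normal : Vec3 → Set where
    lead₁ : ∀ b c → Normal (1# , b , c)
    lead₂ : ∀ c → Normal (0# , 1# , c)
    lead₃ : Normal (0# , 0# , 1#)

  normalized⇒Normal : ∀ {v} → normalized v ≡ true → Normal v
  normalized⇒Normal {a , b , c} n with a ≟ 1#
  ... | yes refl = lead₁ b c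
  ... | no _ with a ≟ 0# | b ≟ 1#
  ...   | yes refl | yes refl = lead₂ c
  ...   | no _ | _ = case n of λ ()
  ...   | yes refl | no _ with b ≟ 0# | c ≟ 1#
  ...     | yes refl | yes refl = lead₃
  ...     | yes refl | no _ = case n of λ ()
  ...     | no _ | _ = case n of λ ()

  Normal⇒normalized : ∀ {v} → Normal v → normalized v ≡ true
  Normal⇒normalized (lead₁ b c) rewrite eqb-≡ (refl {x = 1#}) = refl
  Normal⇒normalized (lead₂ c) rewrite eqb-≢ 0≢1 | eqb-≡ (refl {x = 0#}) | eqb-≡ (refl {x = 1#}) = refl
  Normal⇒normalized lead₃ rewrite eqb-≢ 0≢1 | eqb-≡ (refl {x = 0#}) | eqb-≡ (refl {x = 1#}) = refl

  𝟎 : Vec3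
  𝟎 = 0# , 0# , 0#

  Normal⇒≢𝟎 : ∀ {v} → Normal v → v ≢ 𝟎
  Normal⇒≢𝟎 (lead₁ b c) v≡𝟎 = 1≢0 (cong proj₁ v≡𝟎)
  Normal⇒≢𝟎 (lead₂ c) v≡𝟎 = 1≢0 (cong (proj₁ ∘ proj₂) v≡𝟎)
  Normal⇒≢𝟎 lead₃ v≡𝟎 = 1≢0 (cong (proj₂ ∘ proj₂) v≡𝟎)

  Normal⇒∈allLines : ∀ {l} → Normal l → l ∈ allLines
  Normal⇒∈allLines {a , b , c} nl =
    ∈-filter⁺ (λ v → normalized v Bool.≟ true)
      (∈-cartesianProduct⁺ (∈-allFin a) (∈-cartesianProduct⁺ (∈-allFin b) (∈-allFin c)))
      (Normal⇒normalized nl)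

  -- The three disjuncts of normalized are mutually exclusive because 0# ≢ 1#.
  iverson-normalized : ∀ a b c →
    [ normalized (a , b , c) ] ≡ [ eqb a 1# ] ℕ.+ [ eqb a 0# ] ℕ.* ([ eqb b 1# ] ℕ.+ [ eqb b 0# ] ℕ.* [ eqb c 1# ])
  iverson-normalized a b c with a ≟ 1# | a ≟ 0#
  ... | yes refl | yes 1≡0 = ⊥-elim (1≢0 1≡0)
  ... | yes refl | no _ = refl
  ... | no _ | no _ = refl
  ... | no _ | yes refl with b ≟ 1# | b ≟ 0#
  ...   | yes refl | yes 1≡0 = ⊥-elim (1≢0 1≡0)
  ...   | yes refl | no _ = refl
  ...   | no _ | no _ = refl
  ...   | no _ | yes refl with c ≟ 1#
  ...     | yes _ = refl
  ...     | no _ = refl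

  does-≟-true : ∀ b → does (b Bool.≟ true) ≡ b
  does-≟-true true = refl
  does-≟-true false = refl

  ∑-leading : ∀ {P : Set} (ps : List P) (g : P → ℕ) (h : Fin q × P → ℕ) →
    ∑ (cartesianProduct (allFin q) ps) (λ (a , p) → ([ eqb a 1# ] ℕ.+ [ eqb a 0# ] ℕ.* g p) ℕ.* h (a , p))
      ≡ ∑[ p ∈ ps ] h (1# , p) ℕ.+ ∑[ p ∈ ps ] g p ℕ.* h (0# , p)
  ∑-leading ps g h = begin
    ∑ (cartesianProduct (allFin q) ps) (λ (a , p) → ([ eqb a 1# ] ℕ.+ [ eqb a 0# ] ℕ.* g p) ℕ.* h (a , p))
      ≡⟨ ∑-cartesianProduct (allFin q) ps _ ⟩
    ∑[ a ∈ allFin q ] ∑[ p ∈ ps ] ([ eqb a 1# ] ℕ.+ [ eqb a 0# ] ℕ.* g p) ℕ.* h (a , p)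
      ≡⟨ ∑-cong (allFin q) (λ a → trans (∑-cong ps (λ p → distribute [ eqb a 1# ] [ eqb a 0# ] (g p) (h (a , p))))
                                    (∑-linear ps [ eqb a 1# ] [ eqb a 0# ] (λ p → h (a , p)) (λ p → g p ℕ.* h (a , p)))) ⟩
    ∑[ a ∈ allFin q ] ([ eqb a 1# ] ℕ.* (∑[ p ∈ ps ] h (a , p)) ℕ.+ [ eqb a 0# ] ℕ.* (∑[ p ∈ ps ] g p ℕ.* h (a , p)))
      ≡⟨ ∑-distrib-+ (allFin q) _ _ ⟩
    ∑[ a ∈ allFin q ] [ eqb a 1# ] ℕ.* (∑[ p ∈ ps ] h (a , p)) ℕ.+ ∑[ a ∈ allFin q ] [ eqb a 0# ] ℕ.* (∑[ p ∈ ps ] g p ℕ.* h (a , p))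
      ≡⟨ cong₂ ℕ._+_ (∑-δ-allFin 1# _) (∑-δ-allFin 0# _) ⟩
    ∑[ p ∈ ps ] h (1# , p) ℕ.+ ∑[ p ∈ ps ] g p ℕ.* h (0# , p) ∎
    where
    open ≡-Reasoning
    distribute : ∀ m n k l → (m ℕ.+ n ℕ.* k) ℕ.* l ≡ m ℕ.* l ℕ.+ n ℕ.* (k ℕ.* l)
    distribute m n k l = trans (ℕ.*-distribʳ-+ l m (n ℕ.* k)) (cong (m ℕ.* l ℕ.+_) (ℕ.*-assoc n k l))

  ∑-allLines : ∀ (h : Vec3 → ℕ) → ∑ allLines h
    ≡ ∑[ b ∈ allFin q ] ∑[ c ∈ allFin q ] h (1# , b , c) ℕ.+ (∑[ c ∈ allFin q ] h (0# , 1# , c) ℕ.+ h (0# , 0# , 1#))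
  ∑-allLines h = begin
    ∑ allLines h
      ≡⟨ ∑-filter (λ v → normalized v Bool.≟ true) allVec3 h ⟩
    ∑[ v ∈ allVec3 ] [ does (normalized v Bool.≟ true) ] ℕ.* h v
      ≡⟨ ∑-cong allVec3 (λ (a , b , c) → cong (ℕ._* h (a , b , c))
                           (trans (cong [_] (does-≟-true _)) (iverson-normalized a b c))) ⟩
    ∑ allVec3 (λ (a , bc) → ([ eqb a 1# ] ℕ.+ [ eqb a 0# ] ℕ.* normalized₂ bc) ℕ.* h (a , bc))
      ≡⟨ ∑-leading _ normalized₂ h ⟩
    ∑[ bc ∈ allPairs ] h (1# , bc) ℕ.+ ∑[ bc ∈ allPairs ] normalized₂ bc ℕ.* h (0# , bc)
      ≡⟨ cong₂ ℕ._+_ (∑-cartesianProduct (allFin q) (allFin q) (λ bc → h (1# , bc)))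
                     (trans (∑-leading (allFin q) (λ c → [ eqb c 1# ]) (λ bc → h (0# , bc)))
                            (cong (∑[ c ∈ allFin q ] h (0# , 1# , c) ℕ.+_) (∑-δ-allFin 1# (λ c → h (0# , 0# , c))))) ⟩
    ∑[ b ∈ allFin q ] ∑[ c ∈ allFin q ] h (1# , b , c) ℕ.+ (∑[ c ∈ allFin q ] h (0# , 1# , c) ℕ.+ h (0# , 0# , 1#)) ∎
    where
    open ≡-Reasoning
    allPairs : List (Fin q × Fin q)
    allPairs = cartesianProduct (allFin q) (allFin q)
    normalized₂ : Fin q × Fin q → ℕ
    normalized₂ (b , c) = [ eqb b 1# ] ℕ.+ [ eqb b 0# ] ℕ.* [ eqb c 1# ]

  length-allLines : length allLines ≡ q ℕ.* q ℕ.+ q ℕ.+ 1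
  length-allLines = begin
    length allLines
      ≡⟨ trans (∑-const allLines 1) (ℕ.*-identityʳ _) ⟨
    ∑[ _ ∈ allLines ] 1
      ≡⟨ ∑-allLines _ ⟩
    ∑[ _ ∈ allFin q ] ∑[ _ ∈ allFin q ] 1 ℕ.+ (∑[ _ ∈ allFin q ] 1 ℕ.+ 1)
      ≡⟨ cong₂ (λ m n → m ℕ.+ (n ℕ.+ 1)) (trans (∑-cong (allFin q) (λ _ → ∑-allFin-1)) (∑-allFin-const q)) ∑-allFin-1 ⟩
    q ℕ.* q ℕ.+ (q ℕ.+ 1)
      ≡⟨ ℕ.+-assoc (q ℕ.* q) q 1 ⟨
    q ℕ.* q ℕ.+ q ℕ.+ 1 ∎
    where open ≡-Reasoning

  infix 7 _·_
  _·_ : Vec3 → Vec3 → Fin q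
  (x₀ , x₁ , x₂) · (l₀ , l₁ , l₂) = (x₀ * l₀ + x₁ * l₁) + x₂ * l₂

  ∑-incident : ∀ α β γ → ∑[ l ∈ allLines ] [ incident (α , β , γ) l ]
    ≡ ∑[ b ∈ allFin q ] ∑[ c ∈ allFin q ] [ eqb ((α + β * b) + γ * c) 0# ]
        ℕ.+ (∑[ c ∈ allFin q ] [ eqb (β + γ * c) 0# ] ℕ.+ [ eqb γ 0# ])
  ∑-incident α β γ = trans (∑-allLines _)
    (cong₂ ℕ._+_ (∑-cong (allFin q) (λ b → ∑-cong (allFin q) (λ c → zero-test (on-lead₁ b c))))
                 (cong₂ ℕ._+_ (∑-cong (allFin q) (zero-test ∘ on-lead₂)) (zero-test on-lead₃)))
    where
    zero-test : ∀ {x y} → x ≡ y → [ eqb x 0# ] ≡ [ eqb y 0# ]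
    zero-test = cong (λ z → [ eqb z 0# ])
    on-lead₁ : ∀ b c → (α , β , γ) · (1# , b , c) ≡ (α + β * b) + γ * c
    on-lead₁ = solve 5 (λ α β γ b c → (α :* con 1 :+ β :* b) :+ γ :* c := (α :+ β :* b) :+ γ :* c) refl α β γ
    on-lead₂ : ∀ c → (α , β , γ) · (0# , 1# , c) ≡ β + γ * c
    on-lead₂ = solve 4 (λ α β γ c → (α :* con 0 :+ β :* con 1) :+ γ :* c := β :+ γ :* c) refl α β γ
    on-lead₃ : (α , β , γ) · (0# , 0# , 1#) ≡ γ
    on-lead₃ = solve 3 (λ α β γ → (α :* con 0 :+ β :* con 0) :+ γ :* con 1 := γ) refl α β γ

  -- Split on the last nonzero coordinate of the point: for each of the three shapes of line
  -- coordinates, the incidence condition is a linear or a constant equation in the free coordinate.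
  lines-through : ∀ x → x ≢ 𝟎 → ∑[ l ∈ allLines ] [ incident x l ] ≡ q ℕ.+ 1
  lines-through (α , β , γ) x≢𝟎 with γ ≟ 0# | β ≟ 0#
  ... | no γ≢0 | _ = trans (∑-incident α β γ)
        (cong₂ ℕ._+_ (trans (∑-cong (allFin q) (λ b → roots-linear (α + β * b) γ≢0)) ∑-allFin-1)
                     (cong₂ ℕ._+_ (roots-linear β γ≢0) (cong [_] (eqb-≢ γ≢0))))
  ... | yes refl | no β≢0 = trans (∑-incident α β 0#)
        (cong₂ ℕ._+_ through-lead₁ (cong₂ ℕ._+_ through-lead₂ (cong [_] (eqb-≡ refl))))
    where
    through-lead₁ : ∑[ b ∈ allFin q ] ∑[ c ∈ allFin q ] [ eqb ((α + β * b) + 0# * c) 0# ] ≡ q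
    through-lead₁ = begin
      ∑[ b ∈ allFin q ] ∑[ c ∈ allFin q ] [ eqb ((α + β * b) + 0# * c) 0# ]
        ≡⟨ ∑-cong (allFin q) (λ b → roots-constant (α + β * b)) ⟩
      ∑[ b ∈ allFin q ] q ℕ.* [ eqb (α + β * b) 0# ]
        ≡⟨ ∑-distribˡ-* (allFin q) q _ ⟩
      q ℕ.* (∑[ b ∈ allFin q ] [ eqb (α + β * b) 0# ])
        ≡⟨ cong (q ℕ.*_) (roots-linear α β≢0) ⟩
      q ℕ.* 1
        ≡⟨ ℕ.*-identityʳ q ⟩
      q ∎
      where open ≡-Reasoning
    through-lead₂ : ∑[ c ∈ allFin q ] [ eqb (β + 0# * c) 0# ] ≡ 0
    through-lead₂ = trans (roots-constant β) (trans (cong (λ z → q ℕ.* [ z ]) (eqb-≢ β≢0)) (ℕ.*-zeroʳ q))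
  ... | yes refl | yes refl = trans (∑-incident α 0# 0#)
        (cong₂ ℕ._+_ through-lead₁ (cong₂ ℕ._+_ through-lead₂ (cong [_] (eqb-≡ refl))))
    where
    α≢0 : α ≢ 0#
    α≢0 α≡0 = x≢𝟎 (cong (_, 0# , 0#) α≡0)
    through-lead₁ : ∑[ b ∈ allFin q ] ∑[ c ∈ allFin q ] [ eqb ((α + 0# * b) + 0# * c) 0# ] ≡ 0
    through-lead₁ = begin
      ∑[ b ∈ allFin q ] ∑[ c ∈ allFin q ] [ eqb ((α + 0# * b) + 0# * c) 0# ]
        ≡⟨ ∑-cong (allFin q) (λ b → roots-constant (α + 0# * b)) ⟩
      ∑[ b ∈ allFin q ] q ℕ.* [ eqb (α + 0# * b) 0# ]
        ≡⟨ ∑-distribˡ-* (allFin q) q _ ⟩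
      q ℕ.* (∑[ b ∈ allFin q ] [ eqb (α + 0# * b) 0# ])
        ≡⟨ cong (q ℕ.*_) (roots-constant α) ⟩
      q ℕ.* (q ℕ.* [ eqb α 0# ])
        ≡⟨ cong (λ z → q ℕ.* (q ℕ.* [ z ])) (eqb-≢ α≢0) ⟩
      q ℕ.* (q ℕ.* 0)
        ≡⟨ trans (cong (q ℕ.*_) (ℕ.*-zeroʳ q)) (ℕ.*-zeroʳ q) ⟩
      0 ∎
      where open ≡-Reasoning
    through-lead₂ : ∑[ c ∈ allFin q ] [ eqb (0# + 0# * c) 0# ] ≡ q
    through-lead₂ = trans (roots-constant 0#) (trans (cong (λ z → q ℕ.* [ z ]) (eqb-≡ refl)) (ℕ.*-identityʳ q))

  infixl 6 _⊖_
  _⊖_ : Vec3 → Vec3 → Vec3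
  (a , b , c) ⊖ (d , e , f) = (a - d , b - e , c - f)

  scale : Fin q → Vec3 → Vec3
  scale s (a , b , c) = (s * a , s * b , s * c)

  cross : Vec3 → Vec3 → Vec3
  cross (a , b , c) (d , e , f) = (b * f , c * d , a * e) ⊖ (c * e , a * f , b * d)

  ·-scale : ∀ x s v → x · scale s v ≡ s * (x · v)
  ·-scale (a , b , c) s (d , e , f) =
    solve 7 (λ s a b c d e f → (a :* (s :* d) :+ b :* (s :* e)) :+ c :* (s :* f)
                               := s :* ((a :* d :+ b :* e) :+ c :* f)) refl s a b c d e f

  ·-⊖ : ∀ x v w → x · (v ⊖ w) + x · w ≡ x · v
  ·-⊖ x@(x₀ , x₁ , x₂) (v₀ , v₁ , v₂) w@(w₀ , w₁ , w₂) = begin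
    x · ((v₀ , v₁ , v₂) ⊖ w) + x · w
      ≡⟨ solve 9 (λ x₀ x₁ x₂ d₀ d₁ d₂ w₀ w₁ w₂ →
                   ((x₀ :* d₀ :+ x₁ :* d₁) :+ x₂ :* d₂) :+ ((x₀ :* w₀ :+ x₁ :* w₁) :+ x₂ :* w₂)
                   := (x₀ :* (d₀ :+ w₀) :+ x₁ :* (d₁ :+ w₁)) :+ x₂ :* (d₂ :+ w₂))
                 refl x₀ x₁ x₂ (v₀ - w₀) (v₁ - w₁) (v₂ - w₂) w₀ w₁ w₂ ⟩
    x · (v₀ - w₀ + w₀ , v₁ - w₁ + w₁ , v₂ - w₂ + w₂)
      ≡⟨ cong (x ·_) (cong₂ _,_ (//-rightDividesˡ w₀ v₀)
                       (cong₂ _,_ (//-rightDividesˡ w₁ v₁) (//-rightDividesˡ w₂ v₂))) ⟩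
    x · (v₀ , v₁ , v₂) ∎
    where open ≡-Reasoning

  ⊖-orthogonal : ∀ x v w → x · v ≡ x · w → x · (v ⊖ w) ≡ 0#
  ⊖-orthogonal x v w x·v≡x·w = identityˡ-unique (x · (v ⊖ w)) (x · w) (trans (·-⊖ x v w) x·v≡x·w)

  cross-orthogonalˡ : ∀ x y → x · cross x y ≡ 0#
  cross-orthogonalˡ x@(a , b , c) (d , e , f) = ⊖-orthogonal x _ _
    (solve 6 (λ a b c d e f → (a :* (b :* f) :+ b :* (c :* d)) :+ c :* (a :* e)
                              := (a :* (c :* e) :+ b :* (a :* f)) :+ c :* (b :* d)) refl a b c d e f)

  cross-orthogonalʳ : ∀ x y → y · cross x y ≡ 0#
  cross-orthogonalʳ (a , b , c) y@(d , e , f) = ⊖-orthogonal y _ _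
    (solve 6 (λ a b c d e f → (d :* (b :* f) :+ e :* (c :* d)) :+ f :* (a :* e)
                              := (d :* (c :* e) :+ e :* (a :* f)) :+ f :* (b :* d)) refl a b c d e f)

  Parallel : Vec3 → Vec3 → Set
  Parallel (a , b , c) (d , e , f) = b * f ≡ c * e × c * d ≡ a * f × a * e ≡ b * d

  cross≡𝟎⇒parallel : ∀ x y → cross x y ≡ 𝟎 → Parallel x y
  cross≡𝟎⇒parallel (a , b , c) (d , e , f) x×y≡𝟎 =
    x∙y⁻¹≈ε⇒x≈y _ _ (cong proj₁ x×y≡𝟎) ,
    x∙y⁻¹≈ε⇒x≈y _ _ (cong (proj₁ ∘ proj₂) x×y≡𝟎) ,
    x∙y⁻¹≈ε⇒x≈y _ _ (cong (proj₂ ∘ proj₂) x×y≡𝟎)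

  parallel-Normal⇒≡ : ∀ {x y} → Normal x → Normal y → Parallel x y → x ≡ y
  parallel-Normal⇒≡ (lead₁ b c) (lead₁ b′ c′) (_ , c1≡1c′ , 1b′≡b1) =
    cong₂ (λ s t → 1# , s , t) (units (sym 1b′≡b1)) (units c1≡1c′)
    where
    units : ∀ {s t} → s * 1# ≡ 1# * t → s ≡ t
    units {s} {t} e = trans (sym (*-identityʳ s)) (trans e (*-identityˡ t))
  parallel-Normal⇒≡ (lead₁ b c) (lead₂ c′) (_ , _ , 11≡b0) = ⊥-elim (1*1≢zero (zeroʳ b) 11≡b0)
  parallel-Normal⇒≡ (lead₁ b c) lead₃ (_ , c0≡11 , _) = ⊥-elim (1*1≢zero (zeroʳ c) (sym c0≡11))
  parallel-Normal⇒≡ (lead₂ c) (lead₁ b′ c′) (_ , _ , 0b′≡11) = ⊥-elim (1*1≢zero (zeroˡ b′) (sym 0b′≡11))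
  parallel-Normal⇒≡ (lead₂ c) (lead₂ c′) (1c′≡c1 , _ , _) =
    cong (λ t → 0# , 1# , t) (trans (sym (*-identityʳ c)) (trans (sym 1c′≡c1) (*-identityˡ c′)))
  parallel-Normal⇒≡ (lead₂ c) lead₃ (11≡c0 , _ , _) = ⊥-elim (1*1≢zero (zeroʳ c) 11≡c0)
  parallel-Normal⇒≡ lead₃ (lead₁ b′ c′) (_ , 11≡0c′ , _) = ⊥-elim (1*1≢zero (zeroˡ c′) 11≡0c′)
  parallel-Normal⇒≡ lead₃ (lead₂ c′) (0c′≡11 , _ , _) = ⊥-elim (1*1≢zero (zeroˡ c′) (sym 0c′≡11))
  parallel-Normal⇒≡ lead₃ lead₃ _ = refl

  normalize : ∀ v → v ≢ 𝟎 → Σ[ s ∈ Fin q ] Normal (scale s v)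
  normalize (a , b , c) v≢𝟎 with a ≟ 0# | b ≟ 0# | c ≟ 0#
  ... | no a≢0 | _ | _ =
    a ⁻¹ , subst (λ z → Normal (z , a ⁻¹ * b , a ⁻¹ * c)) (sym (inverseˡ a a≢0)) (lead₁ (a ⁻¹ * b) (a ⁻¹ * c))
  ... | yes refl | no b≢0 | _ =
    b ⁻¹ , subst₂ (λ z w → Normal (z , w , b ⁻¹ * c)) (sym (zeroʳ (b ⁻¹))) (sym (inverseˡ b b≢0)) (lead₂ (b ⁻¹ * c))
  ... | yes refl | yes refl | no c≢0 =
    c ⁻¹ , subst₂ (λ z w → Normal (z , z , w)) (sym (zeroʳ (c ⁻¹))) (sym (inverseˡ c c≢0)) lead₃
  ... | yes refl | yes refl | yes refl = ⊥-elim (v≢𝟎 refl)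

  line-through : ∀ {x y} → Normal x → Normal y → x ≢ y →
    Σ[ l ∈ Vec3 ] (l ∈ allLines × incident x l ≡ true × incident y l ≡ true)
  line-through {x} {y} nx ny x≢y with normalize (cross x y) (x≢y ∘ parallel-Normal⇒≡ nx ny ∘ cross≡𝟎⇒parallel x y)
  ... | s , nl = scale s (cross x y) , Normal⇒∈allLines nl ,
                 on x (cross-orthogonalˡ x y) , on y (cross-orthogonalʳ x y)
    where
    on : ∀ z → z · cross x y ≡ 0# → incident z (scale s (cross x y)) ≡ true
    on z z·l≡0 = eqb-≡ (trans (·-scale z s (cross x y)) (trans (cong (s *_) z·l≡0) (zeroʳ s)))

  common-lines : ∀ {x y} → Normal x → Normal y → x ≢ y →
    1 ≤ ∑[ l ∈ allLines ] [ incident x l ] ℕ.* [ incident y l ]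
  common-lines {x} {y} nx ny x≢y = through (line-through nx ny x≢y)
    where
    through : Σ[ l ∈ Vec3 ] (l ∈ allLines × incident x l ≡ true × incident y l ≡ true) →
              1 ≤ ∑[ l ∈ allLines ] [ incident x l ] ℕ.* [ incident y l ]
    through (l , l∈L , x∈l , y∈l) =
      ≤-trans (≤-reflexive (cong₂ (λ s t → [ s ] ℕ.* [ t ]) (sym x∈l) (sym y∈l)))
              (∈⇒≤∑ (λ l → [ incident x l ] ℕ.* [ incident y l ]) l∈L)

-- The natural-number _+_ and _*_ are opened only from here on: in Geometry they are the field operations.
open import Data.Nat using (_+_; _*_)
open import Data.Nat.Properties
  using (+-identityʳ; *-zeroʳ; *-distribˡ-+; +-mono-≤; +-monoˡ-≤; +-monoʳ-≤; *-monoʳ-≤; +-cancelʳ-≤; module ≤-Reasoning)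
open import Data.Nat.Tactic.RingSolver using (solve-∀)

-- With d = suc e, this is d + k² + c·[k = 3] ≤ d·[k = 0] + (d + 1)·k, i.e. (k - 1)(k - d) ≤ -c·[k = 3]
-- for k ≠ 0; at k = 3 and d = 4 the left side is -2, which allows c = 2.
QuadraticBound : ℕ → ℕ → ℕ → Set
QuadraticBound e c k = suc e + k * k + c * [ does (k ℕ.≟ 3) ] ≤ suc e * [ does (k ℕ.≟ 0) ] + (2 + e) * k

quadratic-bound₃ : ∀ {k} → k ≤ 3 → QuadraticBound 2 0 k
quadratic-bound₃ {0} _ = ≤ᵇ⇒≤ _ _ _
quadratic-bound₃ {1} _ = ≤ᵇ⇒≤ _ _ _
quadratic-bound₃ {2} _ = ≤ᵇ⇒≤ _ _ _
quadratic-bound₃ {3} _ = ≤ᵇ⇒≤ _ _ _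
quadratic-bound₃ {suc (suc (suc (suc _)))} (s≤s (s≤s (s≤s ())))

quadratic-bound₄ : ∀ {k} → k ≤ 4 → QuadraticBound 3 2 k
quadratic-bound₄ {0} _ = ≤ᵇ⇒≤ _ _ _
quadratic-bound₄ {1} _ = ≤ᵇ⇒≤ _ _ _
quadratic-bound₄ {2} _ = ≤ᵇ⇒≤ _ _ _
quadratic-bound₄ {3} _ = ≤ᵇ⇒≤ _ _ _
quadratic-bound₄ {4} _ = ≤ᵇ⇒≤ _ _ _
quadratic-bound₄ {suc (suc (suc (suc (suc _))))} (s≤s (s≤s (s≤s (s≤s ()))))

square-step : ∀ n r Q M → n * r + n * n ≤ Q + n → n ≤ M →
              suc n * r + suc n * suc n ≤ r + 2 * M + Q + suc n
square-step n r Q M IH n≤M = begin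
  suc n * r + suc n * suc n         ≡⟨ expand n r ⟩
  (n * r + n * n) + (r + 2 * n + 1) ≤⟨ +-mono-≤ IH (+-monoˡ-≤ 1 (+-monoʳ-≤ r (*-monoʳ-≤ 2 n≤M))) ⟩
  (Q + n) + (r + 2 * M + 1)         ≡⟨ regroup Q n r M ⟩
  r + 2 * M + Q + suc n             ∎
  where
  open ≤-Reasoning
  expand : ∀ n r → suc n * r + suc n * suc n ≡ (n * r + n * n) + (r + 2 * n + 1)
  expand = solve-∀
  regroup : ∀ Q n r M → (Q + n) + (r + 2 * M + 1) ≡ r + 2 * M + Q + suc n
  regroup = solve-∀

counting-arithmetic : ∀ q e c u₀ u₃ Q →
  (q * q + q + 1) * suc e + Q + c * u₃ ≤ suc e * u₀ + (2 + e) * (suc q * (q + 1)) →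
  suc q * (q + 1) + suc q * suc q ≤ Q + suc q →
  q * q + c * u₃ ≤ suc e * u₀ + e * q
counting-arithmetic q e c u₀ u₃ Q sum-bound square-bound = +-cancelʳ-≤ X _ _ (begin
  q * q + c * u₃ + X
    ≤⟨ +-monoʳ-≤ (q * q + c * u₃) (+-monoʳ-≤ (N * suc e) square-bound) ⟩
  q * q + c * u₃ + (N * suc e + (Q + suc q))
    ≡⟨ regroup q e c u₃ Q ⟩
  (N * suc e + Q + c * u₃) + (q * q + suc q)
    ≤⟨ +-monoˡ-≤ _ sum-bound ⟩
  suc e * u₀ + (2 + e) * (suc q * (q + 1)) + (q * q + suc q)
    ≡⟨ collect q e u₀ ⟩
  suc e * u₀ + e * q + X ∎)
  where
  open ≤-Reasoning
  N = q * q + q + 1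
  X = N * suc e + (suc q * (q + 1) + suc q * suc q)
  regroup : ∀ q e c u₃ Q → q * q + c * u₃ + ((q * q + q + 1) * suc e + (Q + suc q))
                         ≡ ((q * q + q + 1) * suc e + Q + c * u₃) + (q * q + suc q)
  regroup = solve-∀
  collect : ∀ q e u₀ → suc e * u₀ + (2 + e) * (suc q * (q + 1)) + (q * q + suc q)
                     ≡ suc e * u₀ + e * q + ((q * q + q + 1) * suc e + (suc q * (q + 1) + suc q * suc q))
  collect = solve-∀

module Counting {q : ℕ} (F : FiniteField q) where
  open PG2 F
  open Geometry F using (Normal; normalized⇒Normal; Normal⇒≢𝟎; lines-through; common-lines; length-allLines)

  pointsOn-∷ : ∀ x S l → pointsOn (x ∷ S) l ≡ [ incident x l ] + pointsOn S l
  pointsOn-∷ x S l with incident x l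
  ... | true = refl
  ... | false = refl

  u≡∑ : ∀ i S → u i S ≡ ∑[ l ∈ allLines ] [ does (pointsOn S l ℕ.≟ i) ]
  u≡∑ i S = length-filter≡∑ (λ l → pointsOn S l ℕ.≟ i) allLines

  degree-bound : ∀ S {d} → degree S ≤ d → All (λ l → pointsOn S l ≤ d) allLines
  degree-bound S deg = map⁻ (foldr-forcesᵇ (λ m n m⊔n≤d → m⊔n≤o⇒m≤o m n m⊔n≤d , m⊔n≤o⇒n≤o m n m⊔n≤d) 0 _ deg)

  ∑-pointsOn : ∀ {S} → All Normal S → ∑[ l ∈ allLines ] pointsOn S l ≡ length S * (q + 1)
  ∑-pointsOn {[]} [] = trans (∑-const allLines 0) (*-zeroʳ (length allLines))
  ∑-pointsOn {x ∷ S} (nx ∷ nS) = begin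
    ∑[ l ∈ allLines ] pointsOn (x ∷ S) l                      ≡⟨ ∑-cong allLines (pointsOn-∷ x S) ⟩
    ∑[ l ∈ allLines ] ([ incident x l ] + pointsOn S l)         ≡⟨ ∑-distrib-+ allLines _ _ ⟩
    ∑[ l ∈ allLines ] [ incident x l ] + ∑[ l ∈ allLines ] pointsOn S l
      ≡⟨ cong₂ _+_ (lines-through x (Normal⇒≢𝟎 nx)) (∑-pointsOn nS) ⟩
    (q + 1) + length S * (q + 1)                                ∎
    where open ≡-Reasoning

  ∑-concurrent : ∀ {x S} → Normal x → All Normal S → All (x ≢_) S →
    length S ≤ ∑[ l ∈ allLines ] [ incident x l ] * pointsOn S l
  ∑-concurrent nx [] [] = z≤n
  ∑-concurrent {x} {y ∷ S} nx (ny ∷ nS) (x≢y ∷ x∉S) = begin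
    1 + length S
      ≤⟨ +-mono-≤ (common-lines nx ny x≢y) (∑-concurrent nx nS x∉S) ⟩
    ∑[ l ∈ allLines ] [ incident x l ] * [ incident y l ] + ∑[ l ∈ allLines ] [ incident x l ] * pointsOn S l
      ≡⟨ ∑-distrib-+ allLines _ _ ⟨
    ∑[ l ∈ allLines ] ([ incident x l ] * [ incident y l ] + [ incident x l ] * pointsOn S l)
      ≡⟨ ∑-cong allLines (λ l → trans (sym (*-distribˡ-+ [ incident x l ] _ _))
                                        (cong ([ incident x l ] *_) (sym (pointsOn-∷ y S l)))) ⟩
    ∑[ l ∈ allLines ] [ incident x l ] * pointsOn (y ∷ S) l ∎
    where open ≤-Reasoning

  iverson-square : ∀ b k → ([ b ] + k) * ([ b ] + k) ≡ [ b ] + 2 * ([ b ] * k) + k * k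
  iverson-square false k = refl
  iverson-square true = solve-∀

  ∑-pointsOn² : ∀ {S} → All Normal S → Unique S →
    length S * (q + 1) + length S * length S ≤ ∑[ l ∈ allLines ] pointsOn S l * pointsOn S l + length S
  ∑-pointsOn² {[]} [] [] = z≤n
  ∑-pointsOn² {x ∷ S} (nx ∷ nS) (x∉S ∷ S!) = begin
    suc n * (q + 1) + suc n * suc n
      ≤⟨ square-step n (q + 1) _ _ (∑-pointsOn² nS S!) (∑-concurrent nx nS x∉S) ⟩
    (q + 1) + 2 * (∑[ l ∈ allLines ] [ incident x l ] * pointsOn S l) + ∑[ l ∈ allLines ] pointsOn S l * pointsOn S l + suc n
      ≡⟨ cong (_+ suc n) expand ⟨
    ∑[ l ∈ allLines ] pointsOn (x ∷ S) l * pointsOn (x ∷ S) l + suc n ∎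
    where
    open ≤-Reasoning
    n = length S
    expand : ∑[ l ∈ allLines ] pointsOn (x ∷ S) l * pointsOn (x ∷ S) l
           ≡ (q + 1) + 2 * (∑[ l ∈ allLines ] [ incident x l ] * pointsOn S l) + ∑[ l ∈ allLines ] pointsOn S l * pointsOn S l
    expand = begin-equality
      ∑[ l ∈ allLines ] pointsOn (x ∷ S) l * pointsOn (x ∷ S) l
        ≡⟨ ∑-cong allLines (λ l → trans (cong (λ k → k * k) (pointsOn-∷ x S l)) (iverson-square (incident x l) (pointsOn S l))) ⟩
      ∑[ l ∈ allLines ] ([ incident x l ] + 2 * ([ incident x l ] * pointsOn S l) + pointsOn S l * pointsOn S l)
        ≡⟨ trans (∑-distrib-+ allLines _ _) (cong (_+ _) (∑-distrib-+ allLines _ _)) ⟩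
      ∑[ l ∈ allLines ] [ incident x l ] + ∑[ l ∈ allLines ] 2 * ([ incident x l ] * pointsOn S l)
        + ∑[ l ∈ allLines ] pointsOn S l * pointsOn S l
        ≡⟨ cong₂ (λ m n → m + n + _) (lines-through x (Normal⇒≢𝟎 nx)) (∑-distribˡ-* allLines 2 _) ⟩
      (q + 1) + 2 * (∑[ l ∈ allLines ] [ incident x l ] * pointsOn S l) + ∑[ l ∈ allLines ] pointsOn S l * pointsOn S l ∎

  u₀-lower-bound : ∀ e c {S} → All IsPoint S → Unique S → length S ≡ suc q →
    All (QuadraticBound e c ∘ pointsOn S) allLines → q * q + c * u 3 S ≤ suc e * u 0 S + e * q
  u₀-lower-bound e c {S} ps S! |S|≡q+1 bounds =
    counting-arithmetic q e c (u 0 S) (u 3 S) Q sum-bound square-bound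
    where
    open ≤-Reasoning
    k = pointsOn S
    Q = ∑[ l ∈ allLines ] k l * k l
    nS = All.map normalized⇒Normal ps
    square-bound : suc q * (q + 1) + suc q * suc q ≤ Q + suc q
    square-bound = subst (λ n → n * (q + 1) + n * n ≤ Q + n) |S|≡q+1 (∑-pointsOn² nS S!)
    sum-bound : (q * q + q + 1) * suc e + Q + c * u 3 S ≤ suc e * u 0 S + (2 + e) * (suc q * (q + 1))
    sum-bound = begin
      (q * q + q + 1) * suc e + Q + c * u 3 S
        ≡⟨ cong₂ (λ N u₃ → N * suc e + Q + c * u₃) (sym length-allLines) (u≡∑ 3 S) ⟩
      length allLines * suc e + Q + c * (∑[ l ∈ allLines ] [ does (k l ℕ.≟ 3) ])
        ≡⟨ cong₂ _+_ (trans (∑-distrib-+ allLines (λ _ → suc e) (λ l → k l * k l))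
                            (cong (_+ Q) (∑-const allLines (suc e))))
                     (∑-distribˡ-* allLines c (λ l → [ does (k l ℕ.≟ 3) ])) ⟨
      ∑[ l ∈ allLines ] (suc e + k l * k l) + ∑[ l ∈ allLines ] c * [ does (k l ℕ.≟ 3) ]
        ≡⟨ ∑-distrib-+ allLines (λ l → suc e + k l * k l) (λ l → c * [ does (k l ℕ.≟ 3) ]) ⟨
      ∑[ l ∈ allLines ] (suc e + k l * k l + c * [ does (k l ℕ.≟ 3) ])
        ≤⟨ ∑-mono-≤ bounds ⟩
      ∑[ l ∈ allLines ] (suc e * [ does (k l ℕ.≟ 0) ] + (2 + e) * k l)
        ≡⟨ ∑-linear allLines (suc e) (2 + e) _ _ ⟩
      suc e * (∑[ l ∈ allLines ] [ does (k l ℕ.≟ 0) ]) + (2 + e) * (∑[ l ∈ allLines ] k l)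
        ≡⟨ cong₂ (λ u₀ I → suc e * u₀ + (2 + e) * I) (sym (u≡∑ 0 S)) (trans (∑-pointsOn nS) (cong (_* (q + 1)) |S|≡q+1)) ⟩
      suc e * u 0 S + (2 + e) * (suc q * (q + 1)) ∎

theorem4p16 : (q : ℕ) (F : FiniteField q) (S : List (PG2.Point F)) →
    All (PG2.IsPoint F) S → Unique S → length S ≡ suc q →
    (PG2.degree F S ≤ 3 → q * q ≤ 3 * PG2.u F 0 S + 2 * q) ×
    (PG2.degree F S ≤ 4 → q * q + 2 * PG2.u F 3 S ≤ 4 * PG2.u F 0 S + 3 * q)
theorem4p16 q F S ps S! |S|≡q+1 = degree≤3 , degree≤4
  where
  open PG2 F
  open Counting F
  degree≤3 : degree S ≤ 3 → q * q ≤ 3 * u 0 S + 2 * q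
  degree≤3 deg = subst (_≤ 3 * u 0 S + 2 * q) (+-identityʳ (q * q))
    (u₀-lower-bound 2 0 ps S! |S|≡q+1 (All.map quadratic-bound₃ (degree-bound S deg)))
  degree≤4 : degree S ≤ 4 → q * q + 2 * u 3 S ≤ 4 * u 0 S + 3 * q
  degree≤4 deg = u₀-lower-bound 3 2 ps S! |S|≡q+1 (All.map quadratic-bound₄ (degree-bound S deg))
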